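{- Let $A$ be an associative cubic norm structure over a field $F$ of characteristic $0$. For $v=(a,b,c,d)\in W_A=F\oplus A\oplus A\oplus F$ define $$R(v)=\begin{pmatrix}ad+2cb-(c,b)&2b^\#-2ac\\2db-2c^\#&-ad+(b,c)-2bc\end{pmatrix}\in M_2(A).$$ Then $R(v)^2=q(v)\cdot1_2$ for all $v\in W_A$.
   Context: An associative cubic norm structure (ACNS) over $F$ is an associative $F$-algebra $A$ with a cubic form $n:A\to F$ of one of the following types: - $A=F$, with $n(x)=x^3$; - $A$ cubic étale, with $n$ its norm; - $A=F\times C$ with $C$ one of $F$, a quadratic étale algebra, or a quaternion algebra, and $n(x,y)=x\,n_C(y)$ ($n_C$ the norm or reduced norm, with $n_F(y)=y^2$); - $A$ central simple of degree $3$, with $n$ the reduced norm. The adjoint $x\mapsto x^\#$ is the quadratic polynomial map with $x^\#=n(x)x^{ -1}$ for $x$ invertible. The trace pairing $(x,y)$ is the symmetric bilinear form determined by $n(x+y)=n(x)+(x^\#,y)+(x,y^\#)+n(y)$. The quartic form on $W_A$ is $$q((a,b,c,d))=(ad-(b,c))^2+4a\,n(c)+4d\,n(b)-4(b^\#,c^\#).$$ -}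

module Defs where

open import Level using (Level; _⊔_; suc)
open import Data.Nat using (ℕ; zero) renaming (suc to 1+)
open import Data.Product using (_×_; _,_; Σ-syntax)
open import Relation.Binary.PropositionalEquality using (_≡_)
open import Relation.Nullary using (¬_)
open import Algebra.Bundles using (CommutativeRing; Ring)

module _ {c ℓ} (R : CommutativeRing c ℓ) where
  open CommutativeRing R
  natCast : ℕ → Carrier
  natCast zero   = 0#
  natCast (1+ n) = 1# + natCast n

record Field c ℓ : Set (suc (c ⊔ ℓ)) where
  field
    commutativeRing : CommutativeRing c ℓ
  open CommutativeRing commutativeRing public
  field
    1≉0     : ¬ (1# ≈ 0#)
    inverse : ∀ x → ¬ (x ≈ 0#) → Σ[ y ∈ Carrier ] (x * y ≈ 1#)

Char0 : ∀ {c ℓ} → Field c ℓ → Set ℓ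
Char0 F = ∀ n → natCast (Field.commutativeRing F) n ≈ 0# → n ≡ 0
  where open Field F

record Algebra {c ℓ} (F : Field c ℓ) : Set (suc (c ⊔ ℓ)) where
  private module F = Field F
  field
    ring : Ring c ℓ
  open Ring ring public
  field
    ι       : F.Carrier → Carrier
    ι-cong  : ∀ {x y} → x F.≈ y → ι x ≈ ι y
    ι-+     : ∀ x y → ι (x F.+ y) ≈ ι x + ι y
    ι-*     : ∀ x y → ι (x F.* y) ≈ ι x * ι y
    ι-1     : ι F.1# ≈ 1#
    ι-central : ∀ λ' x → ι λ' * x ≈ x * ι λ'

  _·_ : F.Carrier → Carrier → Carrier
  λ' · x = ι λ' * x
  infixl 7 _·_

record ACNS {c ℓ} (F : Field c ℓ) : Set (suc (c ⊔ ℓ)) where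
  private module F = Field F
  field
    algebra : Algebra F
  open Algebra algebra public
  field
    n     : Carrier → F.Carrier
    _♯    : Carrier → Carrier
    ⟨_,_⟩ : Carrier → Carrier → F.Carrier

    n-cong  : ∀ {x y} → x ≈ y → n x F.≈ n y
    ♯-cong  : ∀ {x y} → x ≈ y → x ♯ ≈ y ♯
    ⟨⟩-cong : ∀ {x x' y y'} → x ≈ x' → y ≈ y' → ⟨ x , y ⟩ F.≈ ⟨ x' , y' ⟩

    n-hom  : ∀ λ' x → n (λ' · x) F.≈ (λ' F.* λ' F.* λ') F.* n x
    n-1    : n 1# F.≈ F.1#
    -- x ↦ x# is a quadratic map
    ♯-hom  : ∀ λ' x → (λ' · x) ♯ ≈ (λ' F.* λ') · (x ♯)
    ♯-bilin : ∀ x y z →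
      (x + y + z) ♯ - (x + y) ♯ - (y + z) ♯ - (x + z) ♯ + x ♯ + y ♯ + z ♯ ≈ 0#
    ⟨⟩-sym  : ∀ x y → ⟨ x , y ⟩ F.≈ ⟨ y , x ⟩
    ⟨⟩-+    : ∀ x y z → ⟨ x + y , z ⟩ F.≈ ⟨ x , z ⟩ F.+ ⟨ y , z ⟩
    ⟨⟩-·    : ∀ λ' x y → ⟨ λ' · x , y ⟩ F.≈ λ' F.* ⟨ x , y ⟩
    -- defining identity of the trace pairing
    n-+ : ∀ x y → n (x + y) F.≈ n x F.+ ⟨ x ♯ , y ⟩ F.+ ⟨ x , y ♯ ⟩ F.+ n y
    -- x# = n(x) x⁻¹ (polynomial form)
    adj-r : ∀ x → x * x ♯ ≈ ι (n x)
    adj-l : ∀ x → x ♯ * x ≈ ι (n x)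
    ♯-anti : ∀ x y → (x * y) ♯ ≈ y ♯ * x ♯
    trace-pairing : ∀ x y → ⟨ x , y ⟩ F.≈ ⟨ x * y , 1# ⟩
    ♯-formula : ∀ x →
      x ♯ ≈ x * x - ⟨ x , 1# ⟩ · x + ι ⟨ x ♯ , 1# ⟩

module _ {c ℓ} {F : Field c ℓ} (𝒜 : ACNS F) where
  private module F = Field F
  open ACNS 𝒜

  W : Set c
  W = F.Carrier × Carrier × Carrier × F.Carrier

  q : W → F.Carrier
  q (a , b , c' , d) =
    let t = a F.* d F.- ⟨ b , c' ⟩
        four = natCast F.commutativeRing 4
    in t F.* t F.+ four F.* a F.* n c' F.+ four F.* d F.* n b
         F.- four F.* ⟨ b ♯ , c' ♯ ⟩

  record M₂ : Set c where
    constructor mat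
    field e₁₁ e₁₂ e₂₁ e₂₂ : Carrier

  _⊗_ : M₂ → M₂ → M₂
  mat x₁₁ x₁₂ x₂₁ x₂₂ ⊗ mat y₁₁ y₁₂ y₂₁ y₂₂ =
    mat (x₁₁ * y₁₁ + x₁₂ * y₂₁) (x₁₁ * y₁₂ + x₁₂ * y₂₂)
        (x₂₁ * y₁₁ + x₂₂ * y₂₁) (x₂₁ * y₁₂ + x₂₂ * y₂₂)

  scalarMat : F.Carrier → M₂
  scalarMat λ' = mat (ι λ') 0# 0# (ι λ')

  _≈₂_ : M₂ → M₂ → Set ℓ
  mat x₁₁ x₁₂ x₂₁ x₂₂ ≈₂ mat y₁₁ y₁₂ y₂₁ y₂₂ =
    (x₁₁ ≈ y₁₁) × (x₁₂ ≈ y₁₂) × (x₂₁ ≈ y₂₁) × (x₂₂ ≈ y₂₂)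

  R : W → M₂
  R (a , b , c' , d) =
    let two = ι (natCast F.commutativeRing 2) in
    mat (ι (a F.* d) + two * (c' * b) - ι ⟨ c' , b ⟩)
        (two * (b ♯) - two * (ι a * c'))
        (two * (ι d * b) - two * (c' ♯))
        (- ι (a F.* d) + ι ⟨ b , c' ⟩ - two * (b * c'))

-- Put k = ad - (b,c), P = cb and Q = bc. Then R(v) = (k + 2P, B ; C, -(k + 2Q)) with
-- B = 2b# - 2ac and C = 2db - 2c#, so the off-diagonal entries of R(v)² are 2(PB - BQ) and
-- 2(CP - QC). They vanish because cb·x = x·bc for x ∈ {c, b#} and x·cb = bc·x for x ∈ {b, c#}
-- (using b b# = b# b = n(b)), and B, C are combinations of these. On the diagonal, the
-- identity x² = x# + T(x)x - T(x#) with T(P) = (b,c) and T(P#) = (b#,c#) gives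
-- (k + 2P)² = k² + 4(ad P + P# - (b#,c#)), while BC = 4(d n(b) + a n(c) - ad P - P#);
-- the sum is q(v). The same computation with Q and CB handles the other corner.
module Submission where

open import Data.Nat using (ℕ)
open import Data.Product using (_,_)
open import Algebra.Bundles using (CommutativeRing)
open import Defs
import Algebra.Properties.Ring

module _ {c ℓ} (CR : CommutativeRing c ℓ) where
  open CommutativeRing CR
  open import Algebra.Properties.Ring ring using (x[y-z]≈xy-xz)
  open import Relation.Binary.Reasoning.Setoid setoid

  factor-common-scalar : ∀ s κ a x d y u →
    κ + s * a * x + s * d * y - s * u ≈ κ + s * ((d * y + a * x) - u)
  factor-common-scalar s κ a x d y u = begin
    κ + s * a * x + s * d * y - s * u
      ≈⟨ +-congʳ (+-cong (+-congˡ (*-assoc _ _ _)) (*-assoc _ _ _)) ⟩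
    κ + s * (a * x) + s * (d * y) - s * u
      ≈⟨ +-congʳ (+-assoc _ _ _) ⟩
    κ + (s * (a * x) + s * (d * y)) - s * u
      ≈⟨ +-congʳ (+-congˡ (trans (sym (distribˡ _ _ _)) (*-congˡ (+-comm _ _)))) ⟩
    κ + s * (d * y + a * x) - s * u
      ≈⟨ +-assoc _ _ _ ⟩
    κ + (s * (d * y + a * x) - s * u)
      ≈⟨ +-congˡ (x[y-z]≈xy-xz _ _ _) ⟨
    κ + s * ((d * y + a * x) - u)
      ∎

module AlgebraProperties {c ℓ} {F : Field c ℓ} (𝔸 : Algebra F) where
  private module F = Field F
  open Algebra 𝔸
  open import Algebra.Properties.Ring ring
    using ( x+x≈x⇒x≈0; -‿distribˡ-*; -‿distribʳ-*; x[y-z]≈xy-xz; [y-z]x≈yx-zx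
          ; +-inverseˡ-unique; -‿+-comm; -‿involutive; xyx⁻¹≈y; ⁻¹-anti-homo‿-)
  open import Algebra.Properties.CommutativeSemigroup +-commutativeSemigroup
    using (interchange; x∙yz≈yx∙z)
  open import Relation.Binary.Reasoning.Setoid setoid

  ι-0# : ι F.0# ≈ 0#
  ι-0# = x+x≈x⇒x≈0 _ (trans (sym (ι-+ _ _)) (ι-cong (F.+-identityˡ _)))

  ι-neg : ∀ x → ι (F.- x) ≈ - ι x
  ι-neg x = +-inverseˡ-unique _ _ (begin
    ι (F.- x) + ι x   ≈⟨ ι-+ _ _ ⟨
    ι (F.- x F.+ x)   ≈⟨ ι-cong (F.-‿inverseˡ x) ⟩
    ι F.0#            ≈⟨ ι-0# ⟩
    0#                ∎)

  ι-sub : ∀ x y → ι (x F.- y) ≈ ι x - ι y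
  ι-sub x y = trans (ι-+ x (F.- y)) (+-congˡ (ι-neg y))

  ι-*-swap : ∀ λ' x y → ι λ' * (x * y) ≈ x * (ι λ' * y)
  ι-*-swap λ' x y = begin
    ι λ' * (x * y)  ≈⟨ *-assoc _ _ _ ⟨
    ι λ' * x * y    ≈⟨ *-congʳ (ι-central λ' x) ⟩
    x * ι λ' * y    ≈⟨ *-assoc _ _ _ ⟩
    x * (ι λ' * y)  ∎

  ι*-*-ι* : ∀ λ' μ x y → (ι λ' * x) * (ι μ * y) ≈ ι λ' * ι μ * (x * y)
  ι*-*-ι* λ' μ x y = begin
    ι λ' * x * (ι μ * y)    ≈⟨ *-assoc _ _ _ ⟩
    ι λ' * (x * (ι μ * y))  ≈⟨ *-congˡ (ι-*-swap μ x y) ⟨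
    ι λ' * (ι μ * (x * y))  ≈⟨ *-assoc _ _ _ ⟨
    ι λ' * ι μ * (x * y)    ∎

  ι*-*-ι*-fused : ∀ λ' μ x y → (ι λ' * x) * (ι μ * y) ≈ ι (λ' F.* μ) * (x * y)
  ι*-*-ι*-fused λ' μ x y = trans (ι*-*-ι* λ' μ x y) (*-congʳ (sym (ι-* λ' μ)))

  two four : Carrier
  two  = ι (natCast F.commutativeRing 2)
  four = two * two

  ι-natCast-4 : ι (natCast F.commutativeRing 4) ≈ four
  ι-natCast-4 = trans (ι-cong (×1-homo-* 2 2)) (ι-* _ _)
    where open import Algebra.Properties.Semiring.Mult F.semiring using (×1-homo-*)

  two+two≈four : two + two ≈ four
  two+two≈four = trans (sym (ι-+ _ _)) (trans (ι-cong (F.sym (×-homo-+ F.1# 2 2))) ι-natCast-4)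
    where open import Algebra.Properties.Semiring.Mult F.semiring using (×-homo-+)

  square-affine : ∀ k x →
    (ι k + two * x) * (ι k + two * x) ≈ ι (k F.* k) + four * ((ι k + x) * x)
  square-affine k x = begin
    (κ + two * x) * (κ + two * x)
      ≈⟨ distribʳ _ _ _ ⟩
    κ * (κ + two * x) + two * x * (κ + two * x)
      ≈⟨ +-cong (distribˡ _ _ _) (distribˡ _ _ _) ⟩
    (κ * κ + κ * (two * x)) + (two * x * κ + two * x * (two * x))
      ≈⟨ +-cong (+-cong (sym (ι-* k k)) (ι-*-swap k two x))
                (+-cong (trans (*-assoc _ _ _) (*-congˡ (sym (ι-central k x))))
                        (ι*-*-ι* _ _ x x)) ⟩
    (ι (k F.* k) + two * (κ * x)) + (two * (κ * x) + four * (x * x))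
      ≈⟨ +-assoc _ _ _ ⟩
    ι (k F.* k) + (two * (κ * x) + (two * (κ * x) + four * (x * x)))
      ≈⟨ +-congˡ (+-assoc _ _ _) ⟨
    ι (k F.* k) + ((two * (κ * x) + two * (κ * x)) + four * (x * x))
      ≈⟨ +-congˡ (+-congʳ (trans (sym (distribʳ _ _ _)) (*-congʳ two+two≈four))) ⟩
    ι (k F.* k) + (four * (κ * x) + four * (x * x))
      ≈⟨ +-congˡ (trans (*-congˡ (distribʳ _ _ _)) (distribˡ _ _ _)) ⟨
    ι (k F.* k) + four * ((κ + x) * x)
      ∎
    where κ = ι k

  difference-product : ∀ λ' p q r s →
    (ι λ' * p - ι λ' * q) * (ι λ' * r - ι λ' * s)
      ≈ ι λ' * ι λ' * ((p * r + q * s) - (p * s + q * r))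
  difference-product λ' p q r s = begin
    (ι λ' * p - ι λ' * q) * (ι λ' * r - ι λ' * s)
      ≈⟨ *-cong (x[y-z]≈xy-xz _ _ _) (x[y-z]≈xy-xz _ _ _) ⟨
    ι λ' * (p - q) * (ι λ' * (r - s))
      ≈⟨ ι*-*-ι* _ _ _ _ ⟩
    ι λ' * ι λ' * ((p - q) * (r - s))
      ≈⟨ *-congˡ (expand p q r s) ⟩
    ι λ' * ι λ' * ((p * r + q * s) - (p * s + q * r))
      ∎
    where
    expand : ∀ p q r s → (p - q) * (r - s) ≈ (p * r + q * s) - (p * s + q * r)
    expand p q r s = begin
      (p - q) * (r - s)                      ≈⟨ [y-z]x≈yx-zx _ _ _ ⟩
      p * (r - s) - q * (r - s)              ≈⟨ +-cong (x[y-z]≈xy-xz _ _ _)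
                                                       (-‿cong (x[y-z]≈xy-xz _ _ _)) ⟩
      (p * r - p * s) - (q * r - q * s)      ≈⟨ +-congˡ (⁻¹-anti-homo‿- _ _) ⟩
      (p * r - p * s) + (q * s - q * r)      ≈⟨ interchange _ _ _ _ ⟩
      (p * r + q * s) + (- (p * s) - q * r)  ≈⟨ +-congˡ (-‿+-comm _ _) ⟩
      (p * r + q * s) - (p * s + q * r)      ∎

  [s-u]+[w-s]≈w-u : ∀ s u w → (s - u) + (w - s) ≈ w - u
  [s-u]+[w-s]≈w-u s u w = begin
    (s - u) + (w - s)    ≈⟨ +-assoc _ _ _ ⟩
    s + (- u + (w - s))  ≈⟨ +-congˡ (x∙yz≈yx∙z _ _ _) ⟩
    s + ((w - u) - s)    ≈⟨ +-assoc _ _ _ ⟨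
    s + (w - u) - s      ≈⟨ xyx⁻¹≈y _ _ ⟩
    w - u                ∎

  square-plus-correction : ∀ k x s u w z →
    (ι k + x) * x ≈ s - u → z ≈ four * (w - s) →
    (ι k + two * x) * (ι k + two * x) + z ≈ ι (k F.* k) + four * (w - u)
  square-plus-correction k x s u w z [k+x]x≈s-u z≈4[w-s] = begin
    (ι k + two * x) * (ι k + two * x) + z
      ≈⟨ +-cong (square-affine k x) z≈4[w-s] ⟩
    ι (k F.* k) + four * ((ι k + x) * x) + four * (w - s)
      ≈⟨ +-congʳ (+-congˡ (*-congˡ [k+x]x≈s-u)) ⟩
    ι (k F.* k) + four * (s - u) + four * (w - s)
      ≈⟨ +-assoc _ _ _ ⟩
    ι (k F.* k) + (four * (s - u) + four * (w - s))
      ≈⟨ +-congˡ (trans (sym (distribˡ _ _ _)) (*-congˡ ([s-u]+[w-s]≈w-u s u w))) ⟩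
    ι (k F.* k) + four * (w - u)
      ∎

  -x*-y≈x*y : ∀ x y → - x * - y ≈ x * y
  -x*-y≈x*y x y = begin
    - x * - y      ≈⟨ -‿distribˡ-* x (- y) ⟨
    - (x * - y)    ≈⟨ -‿cong (-‿distribʳ-* x y) ⟨
    - - (x * y)    ≈⟨ -‿involutive _ ⟩
    x * y          ∎

  Intertwines : Carrier → Carrier → Carrier → Set ℓ
  Intertwines p q x = p * x ≈ x * q

  intertwines-assoc : ∀ x y → Intertwines (x * y) (y * x) x
  intertwines-assoc x y = *-assoc x y x

  intertwines-+ : ∀ {p q p' q' x} →
    Intertwines p q x → Intertwines p' q' x → Intertwines (p + p') (q + q') x
  intertwines-+ {p} {q} {p'} {q'} {x} px≈xq p'x≈xq' = begin
    (p + p') * x     ≈⟨ distribʳ _ _ _ ⟩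
    p * x + p' * x   ≈⟨ +-cong px≈xq p'x≈xq' ⟩
    x * q + x * q'   ≈⟨ distribˡ _ _ _ ⟨
    x * (q + q')     ∎

  intertwines-scale-pair : ∀ λ' {p q x} →
    Intertwines p q x → Intertwines (ι λ' * p) (ι λ' * q) x
  intertwines-scale-pair λ' {p} {q} {x} px≈xq = begin
    ι λ' * p * x    ≈⟨ *-assoc _ _ _ ⟩
    ι λ' * (p * x)  ≈⟨ *-congˡ px≈xq ⟩
    ι λ' * (x * q)  ≈⟨ ι-*-swap λ' x q ⟩
    x * (ι λ' * q)  ∎

  intertwines-scale : ∀ λ' {p q x} → Intertwines p q x → Intertwines p q (ι λ' * x)
  intertwines-scale λ' {p} {q} {x} px≈xq = begin
    p * (ι λ' * x)  ≈⟨ ι-*-swap λ' p x ⟨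
    ι λ' * (p * x)  ≈⟨ *-congˡ px≈xq ⟩
    ι λ' * (x * q)  ≈⟨ *-assoc _ _ _ ⟨
    ι λ' * x * q    ∎

  intertwines-sub : ∀ {p q x y} →
    Intertwines p q x → Intertwines p q y → Intertwines p q (x - y)
  intertwines-sub {p} {q} {x} {y} px≈xq py≈yq = begin
    p * (x - y)      ≈⟨ x[y-z]≈xy-xz _ _ _ ⟩
    p * x - p * y    ≈⟨ +-cong px≈xq (-‿cong py≈yq) ⟩
    x * q - y * q    ≈⟨ [y-z]x≈yx-zx _ _ _ ⟨
    (x - y) * q      ∎

  intertwines⇒px+x[-q]≈0 : ∀ {p q x} → Intertwines p q x → p * x + x * - q ≈ 0#
  intertwines⇒px+x[-q]≈0 {p} {q} {x} px≈xq = begin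
    p * x + x * - q    ≈⟨ +-cong px≈xq (sym (-‿distribʳ-* x q)) ⟩
    x * q - x * q      ≈⟨ -‿inverseʳ _ ⟩
    0#                 ∎

  intertwines⇒xq+[-p]x≈0 : ∀ {p q x} → Intertwines p q x → x * q + - p * x ≈ 0#
  intertwines⇒xq+[-p]x≈0 {p} {q} {x} px≈xq = begin
    x * q + - p * x    ≈⟨ +-congˡ (sym (-‿distribˡ-* p x)) ⟩
    x * q - p * x      ≈⟨ +-congˡ (-‿cong px≈xq) ⟩
    x * q - x * q      ≈⟨ -‿inverseʳ _ ⟩
    0#                 ∎

module CubicNormProperties {f ℓ} {F : Field f ℓ} (𝒜 : ACNS F) where
  private module F = Field F
  open ACNS 𝒜
  open AlgebraProperties algebra
  open import Algebra.Properties.Ring ring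
    using (//-rightDividesˡ; //-rightDividesʳ; ⁻¹-anti-homo‿-; -‿+-comm)
  open import Algebra.Properties.CommutativeSemigroup +-commutativeSemigroup using (xy∙z≈xz∙y)
  open import Relation.Binary.Reasoning.Setoid setoid

  T : Carrier → F.Carrier
  T x = ⟨ x , 1# ⟩

  square-by-adjoint : ∀ x → x * x ≈ x ♯ + ι (T x) * x - ι (T (x ♯))
  square-by-adjoint x = sym (begin
    x ♯ + τx - ι (T (x ♯))                         ≈⟨ +-congʳ (+-congʳ (♯-formula x)) ⟩
    x * x - τx + ι (T (x ♯)) + τx - ι (T (x ♯))    ≈⟨ +-congʳ (xy∙z≈xz∙y _ _ _) ⟩
    x * x - τx + τx + ι (T (x ♯)) - ι (T (x ♯))    ≈⟨ //-rightDividesʳ _ _ ⟩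
    x * x - τx + τx                                ≈⟨ //-rightDividesˡ _ _ ⟩
    x * x                                          ∎)
    where τx = ι (T x) * x

  shifted-square : ∀ k x → (ι k + x) * x ≈ ι (k F.+ T x) * x + x ♯ - ι (T (x ♯))
  shifted-square k x = begin
    (ι k + x) * x                                   ≈⟨ distribʳ _ _ _ ⟩
    ι k * x + x * x                                 ≈⟨ +-congˡ (square-by-adjoint x) ⟩
    ι k * x + (x ♯ + ι (T x) * x - ι (T (x ♯)))     ≈⟨ +-assoc _ _ _ ⟨
    ι k * x + (x ♯ + ι (T x) * x) - ι (T (x ♯))     ≈⟨ +-congʳ (+-congˡ (+-comm _ _)) ⟩
    ι k * x + (ι (T x) * x + x ♯) - ι (T (x ♯))     ≈⟨ +-congʳ (+-assoc _ _ _) ⟨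
    ι k * x + ι (T x) * x + x ♯ - ι (T (x ♯))       ≈⟨ +-congʳ (+-congʳ (distribʳ _ _ _)) ⟨
    (ι k + ι (T x)) * x + x ♯ - ι (T (x ♯))         ≈⟨ +-congʳ (+-congʳ (*-congʳ (ι-+ _ _))) ⟨
    ι (k F.+ T x) * x + x ♯ - ι (T (x ♯))           ∎

  trace-product : ∀ x y → T (x * y) F.≈ ⟨ x , y ⟩
  trace-product x y = F.sym (trace-pairing x y)

  trace-adjoint-product : ∀ x y → T ((x * y) ♯) F.≈ ⟨ y ♯ , x ♯ ⟩
  trace-adjoint-product x y = F.trans (⟨⟩-cong (♯-anti x y) refl) (trace-product _ _)

  intertwines-adjoint : ∀ x y → Intertwines (x * y) (y * x) (y ♯)
  intertwines-adjoint x y = begin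
    x * y * y ♯      ≈⟨ *-assoc _ _ _ ⟩
    x * (y * y ♯)    ≈⟨ *-congˡ (adj-r y) ⟩
    x * ι (n y)      ≈⟨ ι-central _ _ ⟨
    ι (n y) * x      ≈⟨ *-congʳ (adj-l y) ⟨
    y ♯ * y * x      ≈⟨ *-assoc _ _ _ ⟩
    y ♯ * (y * x)    ∎

  ι*-*-adjoint : ∀ λ' x → (ι λ' * x) * x ♯ ≈ ι (λ' F.* n x)
  ι*-*-adjoint λ' x = begin
    ι λ' * x * x ♯      ≈⟨ *-assoc _ _ _ ⟩
    ι λ' * (x * x ♯)    ≈⟨ *-congˡ (adj-r x) ⟩
    ι λ' * ι (n x)      ≈⟨ ι-* _ _ ⟨
    ι (λ' F.* n x)      ∎

  adjoint-*-ι* : ∀ λ' x → x ♯ * (ι λ' * x) ≈ ι (λ' F.* n x)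
  adjoint-*-ι* λ' x = begin
    x ♯ * (ι λ' * x)    ≈⟨ ι-*-swap _ _ _ ⟨
    ι λ' * (x ♯ * x)    ≈⟨ *-congˡ (adj-l x) ⟩
    ι λ' * ι (n x)      ≈⟨ ι-* _ _ ⟨
    ι (λ' F.* n x)      ∎

  module Entries (a : F.Carrier) (b c : Carrier) (d : F.Carrier) where
    private module FP = Algebra.Properties.Ring F.ring

    v : W 𝒜
    v = a , b , c , d

    R₁₁ R₁₂ R₂₁ R₂₂ : Carrier
    R₁₁ = M₂.e₁₁ (R 𝒜 v)
    R₁₂ = M₂.e₁₂ (R 𝒜 v)
    R₂₁ = M₂.e₂₁ (R 𝒜 v)
    R₂₂ = M₂.e₂₂ (R 𝒜 v)

    N : ℕ → F.Carrier
    N = natCast F.commutativeRing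

    t U k : F.Carrier
    t = ⟨ b , c ⟩
    U = ⟨ b ♯ , c ♯ ⟩
    k = a F.* d F.- t

    P Q : Carrier
    P = c * b
    Q = b * c

    R₁₁≈ι[k]+two*P : R₁₁ ≈ ι k + two * P
    R₁₁≈ι[k]+two*P = begin
      ι (a F.* d) + two * P - ι ⟨ c , b ⟩
        ≈⟨ xy∙z≈xz∙y _ _ _ ⟩
      ι (a F.* d) - ι ⟨ c , b ⟩ + two * P
        ≈⟨ +-congʳ (ι-sub _ _) ⟨
      ι (a F.* d F.- ⟨ c , b ⟩) + two * P
        ≈⟨ +-congʳ (ι-cong (F.+-congˡ (F.-‿cong (⟨⟩-sym c b)))) ⟩
      ι k + two * P
        ∎

    R₂₂≈-[ι[k]+two*Q] : R₂₂ ≈ - (ι k + two * Q)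
    R₂₂≈-[ι[k]+two*Q] = begin
      - ι (a F.* d) + ι t - two * Q        ≈⟨ +-congʳ (+-comm _ _) ⟩
      ι t - ι (a F.* d) - two * Q          ≈⟨ +-congʳ (⁻¹-anti-homo‿- _ _) ⟨
      - (ι (a F.* d) - ι t) - two * Q      ≈⟨ +-congʳ (-‿cong (ι-sub _ _)) ⟨
      - ι k - two * Q                      ≈⟨ -‿+-comm _ _ ⟩
      - (ι k + two * Q)                    ∎

    R₁₂-intertwines : Intertwines (ι k + two * P) (ι k + two * Q) R₁₂
    R₁₂-intertwines = intertwines-+ (ι-central k _) (intertwines-scale-pair _ PQ-R₁₂)
      where
      PQ-R₁₂ : Intertwines P Q R₁₂
      PQ-R₁₂ = intertwines-sub (intertwines-scale _ (intertwines-adjoint c b))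
                             (intertwines-scale _ (intertwines-scale a (intertwines-assoc c b)))

    R₂₁-intertwines : Intertwines (ι k + two * Q) (ι k + two * P) R₂₁
    R₂₁-intertwines = intertwines-+ (ι-central k _) (intertwines-scale-pair _ QP-R₂₁)
      where
      QP-R₂₁ : Intertwines Q P R₂₁
      QP-R₂₁ = intertwines-sub (intertwines-scale _ (intertwines-scale d (intertwines-assoc b c)))
                             (intertwines-scale _ (intertwines-adjoint b c))

    w : Carrier
    w = ι (d F.* n b) + ι (a F.* n c)

    shifted-square-with-traces : ∀ x → T x F.≈ t → T (x ♯) F.≈ U →
      (ι k + x) * x ≈ ι (a F.* d) * x + x ♯ - ι U
    shifted-square-with-traces x Tx≈t Tx♯≈U = begin
      (ι k + x) * x                            ≈⟨ shifted-square k x ⟩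
      ι (k F.+ T x) * x + x ♯ - ι (T (x ♯))    ≈⟨ +-cong (+-congʳ (*-congʳ (ι-cong k+Tx≈ad)))
                                                        (-‿cong (ι-cong Tx♯≈U)) ⟩
      ι (a F.* d) * x + x ♯ - ι U              ∎
      where
      k+Tx≈ad : k F.+ T x F.≈ a F.* d
      k+Tx≈ad = F.trans (F.+-congˡ Tx≈t) (FP.//-rightDividesˡ t (a F.* d))

    R₁₂*R₂₁ : R₁₂ * R₂₁ ≈ four * (w - (ι (a F.* d) * P + P ♯))
    R₁₂*R₂₁ = trans (difference-product _ (b ♯) (ι a * c) (ι d * b) (c ♯))
      (*-congˡ (+-cong (+-cong (adjoint-*-ι* d b) (ι*-*-adjoint a c))
                       (-‿cong (trans (+-comm _ _)
                                      (+-cong (ι*-*-ι*-fused a d c b) (sym (♯-anti c b)))))))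

    R₂₁*R₁₂ : R₂₁ * R₁₂ ≈ four * (w - (ι (a F.* d) * Q + Q ♯))
    R₂₁*R₁₂ = trans (difference-product _ (ι d * b) (c ♯) (b ♯) (ι a * c))
      (*-congˡ (+-cong (+-cong (ι*-*-adjoint d b) (adjoint-*-ι* a c))
                       (-‿cong (+-cong (trans (ι*-*-ι*-fused d a b c)
                                              (*-congʳ (ι-cong (F.*-comm d a))))
                                       (sym (♯-anti b c))))))

    q-expansion : q 𝒜 v F.≈ k F.* k F.+ N 4 F.* ((d F.* n b F.+ a F.* n c) F.- U)
    q-expansion = factor-common-scalar F.commutativeRing _ _ _ _ _ _ _

    ι[q]-expansion : ι (k F.* k) + four * (w - ι U) ≈ ι (q 𝒜 v)
    ι[q]-expansion = sym (begin
      ι (q 𝒜 v)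
        ≈⟨ ι-cong q-expansion ⟩
      ι (k F.* k F.+ N 4 F.* ((d F.* n b F.+ a F.* n c) F.- U))
        ≈⟨ trans (ι-+ _ _) (+-congˡ (ι-* _ _)) ⟩
      ι (k F.* k) + ι (N 4) * ι ((d F.* n b F.+ a F.* n c) F.- U)
        ≈⟨ +-congˡ (*-cong ι-natCast-4 (trans (ι-sub _ _) (+-congʳ (ι-+ _ _)))) ⟩
      ι (k F.* k) + four * (w - ι U)
        ∎)

    entry₁₁ : R₁₁ * R₁₁ + R₁₂ * R₂₁ ≈ ι (q 𝒜 v)
    entry₁₁ = begin
      R₁₁ * R₁₁ + R₁₂ * R₂₁
        ≈⟨ +-congʳ (*-cong R₁₁≈ι[k]+two*P R₁₁≈ι[k]+two*P) ⟩
      (ι k + two * P) * (ι k + two * P) + R₁₂ * R₂₁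
        ≈⟨ square-plus-correction k P _ (ι U) w _
             (shifted-square-with-traces P T-P T-P♯) R₁₂*R₂₁ ⟩
      ι (k F.* k) + four * (w - ι U)
        ≈⟨ ι[q]-expansion ⟩
      ι (q 𝒜 v)
        ∎
      where
      T-P : T P F.≈ t
      T-P = F.trans (trace-product c b) (⟨⟩-sym c b)
      T-P♯ : T (P ♯) F.≈ U
      T-P♯ = trace-adjoint-product c b

    entry₂₂ : R₂₁ * R₁₂ + R₂₂ * R₂₂ ≈ ι (q 𝒜 v)
    entry₂₂ = begin
      R₂₁ * R₁₂ + R₂₂ * R₂₂
        ≈⟨ +-congˡ (trans (*-cong R₂₂≈-[ι[k]+two*Q] R₂₂≈-[ι[k]+two*Q]) (-x*-y≈x*y _ _)) ⟩
      R₂₁ * R₁₂ + (ι k + two * Q) * (ι k + two * Q)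
        ≈⟨ +-comm _ _ ⟩
      (ι k + two * Q) * (ι k + two * Q) + R₂₁ * R₁₂
        ≈⟨ square-plus-correction k Q _ (ι U) w _
             (shifted-square-with-traces Q T-Q T-Q♯) R₂₁*R₁₂ ⟩
      ι (k F.* k) + four * (w - ι U)
        ≈⟨ ι[q]-expansion ⟩
      ι (q 𝒜 v)
        ∎
      where
      T-Q : T Q F.≈ t
      T-Q = trace-product b c
      T-Q♯ : T (Q ♯) F.≈ U
      T-Q♯ = F.trans (trace-adjoint-product b c) (⟨⟩-sym _ _)

    entry₁₂ : R₁₁ * R₁₂ + R₁₂ * R₂₂ ≈ 0#
    entry₁₂ = trans (+-cong (*-congʳ R₁₁≈ι[k]+two*P) (*-congˡ R₂₂≈-[ι[k]+two*Q]))
                    (intertwines⇒px+x[-q]≈0 R₁₂-intertwines)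

    entry₂₁ : R₂₁ * R₁₁ + R₂₂ * R₂₁ ≈ 0#
    entry₂₁ = trans (+-cong (*-congˡ R₁₁≈ι[k]+two*P) (*-congʳ R₂₂≈-[ι[k]+two*Q]))
                    (intertwines⇒xq+[-p]x≈0 R₂₁-intertwines)

proposition4p16 : ∀ {c ℓ} (F : Field c ℓ) → Char0 F → (𝒜 : ACNS F) →
    ∀ v → _≈₂_ 𝒜 (_⊗_ 𝒜 (R 𝒜 v) (R 𝒜 v)) (scalarMat 𝒜 (q 𝒜 v))
proposition4p16 F _ 𝒜 (a , b , c , d) = entry₁₁ , entry₁₂ , entry₂₁ , entry₂₂
  where open CubicNormProperties.Entries 𝒜 a b c d
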